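{- Let $\preceq$ be a relaxed monomial order on $\mathbb{N}^2$ with $\mathbf{e}_1\prec\mathbf{e}_2$. Let $S\in\operatorname{R}_\preceq(\mathcal{S}_2)\setminus\{\mathbb{N}^2\}$ be such that $\mathbf{e}_2\in S$ and $\mathbf{e}_2\prec\mathbf{F}_\preceq(S)$. Then for all $T\in\mathcal{D}(S)$ and all $\mathbf{n}\in\mathbf{U}_\preceq(T)$ we have $T\setminus\{\mathbf{n}\}\in\operatorname{R}_\preceq(\mathcal{S}_2)$.
   Context: $\mathbf{e}_1=(0,1)$ and $\mathbf{e}_2=(1,0)$. A generalized numerical semigroup (GNS) in $\mathbb{N}^d$ is a submonoid $S$ of $(\mathbb{N}^d,+)$ with $\operatorname{H}(S)=\mathbb{N}^d\setminus S$ finite; $|\operatorname{H}(S)|$ is its genus; $\mathcal{S}_{d}$ is the set of GNSs in $\mathbb{N}^d$ and $\mathcal{S}_{g,d}$ those of genus $g$. $\operatorname{A}(S)=S^*\setminus(S^*+S^*)$, $S^*=S\setminus\{\mathbf{0}\}$. $\operatorname{P}_d$ is the set of permutations of $\{1,\ldots,d\}$, acting by $\sigma(\sum x_i\mathbf{e}_i)=\sum x_i\mathbf{e}_{\sigma(i)}$ and elementwise on sets; $[S]_\simeq=\{\sigma(S)\mid\sigma\in\operatorname{P}_d\}$. A relaxed monomial order is a total order $\preceq$ on $\mathbb{N}^d$ with $\mathbf{0}\preceq\mathbf{v}$ for all $\mathbf{v}$ and such that $\mathbf{v}\prec\mathbf{w}$ implies $\mathbf{v}\prec\mathbf{w}+\mathbf{u}$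 for all $\mathbf{u}$. $\mathbf{F}_\preceq(S)=\max_\preceq\operatorname{H}(S)$ and $\mathbf{U}_\preceq(S)=\{\mathbf{x}\in\operatorname{A}(S)\mid\mathbf{F}_\preceq(S)\prec\mathbf{x}\}$. For $S,S'\in\mathcal{S}_{g,d}$ with gaps $\mathbf{h}_1\prec\cdots\prec\mathbf{h}_g$ and $\mathbf{h}'_1\prec\cdots\prec\mathbf{h}'_g$, $S\preceq_{\operatorname{R}}S'$ means $S=S'$ or $\mathbf{h}_r\prec\mathbf{h}'_r$ for $r=\min\{i\mid\mathbf{h}_i\neq\mathbf{h}'_i\}$; $\operatorname{R}_\preceq(S)=\min_{\preceq_{\operatorname{R}}}[S]_\simeq$ and $\operatorname{R}_\preceq(\mathcal{S}_d)=\{\operatorname{R}_\preceq(S)\mid S\in\mathcal{S}_d\}$. For $S\in\operatorname{R}_\preceq(\mathcal{S}_d)$, $\mathcal{D}(S)$ is the set of $T\in\operatorname{R}_\preceq(\mathcal{S}_d)$ for which there exist $T_1,\ldots,T_n\in\operatorname{R}_\preceq(\mathcal{S}_d)$ ($n\ge1$) with $T_1=T$, $T_n=S$ and $T_{i+1}=T_i\cup\{\mathbf{F}_\preceq(T_i)\}$ for all $i\in\{1,\ldots,n-1\}$ (i.e., $S$ together with its descendants in the tree of representatives). -}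

module Defs where

open import Data.Nat using (ℕ; zero; suc; _+_)
open import Data.Product using (Σ; ∃; _×_; _,_)
open import Data.Sum using (_⊎_)
open import Data.List using (List; []; _∷_; _++_)
open import Data.List.Membership.Propositional using (_∈_)
open import Data.List.Relation.Unary.Linked using (Linked)
open import Relation.Nullary using (¬_)
open import Relation.Binary.PropositionalEquality using (_≡_; _≢_)
open import Relation.Binary.Structures using (IsTotalOrder)

Pt : Set
Pt = ℕ × ℕ

_⊕_ : Pt → Pt → Pt
(a , b) ⊕ (c , d) = (a + c , b + d)

𝟎 : Pt
𝟎 = (0 , 0)

-- As in the paper's context: e₁ = (0,1), e₂ = (1,0).
e₁ e₂ : Pt
e₁ = (0 , 1)
e₂ = (1 , 0)

swap : Pt → Pt
swap (a , b) = (b , a)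

Subset : Set₁
Subset = Pt → Set

_⇔_ : Set → Set → Set
A ⇔ B = (A → B) × (B → A)

_≐_ : Subset → Subset → Set
S ≐ T = ∀ x → S x ⇔ T x

swapS : Subset → Subset
swapS S x = S (swap x)

record IsGNS (S : Subset) : Set where
  field
    has-zero : S 𝟎
    closed   : ∀ x y → S x → S y → S (x ⊕ y)
    finite-gaps : ∃ λ (L : List Pt) → ∀ x → (¬ S x) ⇔ (x ∈ L)

module _ (_≼_ : Pt → Pt → Set) where

  _≺_ : Pt → Pt → Set
  v ≺ w = (v ≼ w) × (v ≢ w)

  record IsRelaxedMonomialOrder : Set where
    field
      isTotalOrder : IsTotalOrder _≡_ _≼_
      zero-least   : ∀ v → 𝟎 ≼ v
      compat       : ∀ v w u → v ≺ w → v ≺ (w ⊕ u)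

  IsFrob : Subset → Pt → Set
  IsFrob S f = (¬ S f) × (∀ h → ¬ S h → h ≼ f)

  GapSeq : Subset → List Pt → Set
  GapSeq S hs = Linked _≺_ hs × (∀ x → (x ∈ hs) ⇔ (¬ S x))

  LexLt : List Pt → List Pt → Set
  LexLt hs hs' = ∃ λ (p : List Pt) → ∃ λ a → ∃ λ b → ∃ λ (rs : List Pt) → ∃ λ (rs' : List Pt) →
    (hs ≡ p ++ (a ∷ rs)) × (hs' ≡ p ++ (b ∷ rs')) × (a ≺ b)

  _≼R_ : Subset → Subset → Set
  S ≼R S' = (S ≐ S') ⊎ (∃ λ hs → ∃ λ hs' → GapSeq S hs × GapSeq S' hs' × LexLt hs hs')

  -- S ∈ R_≼(𝒮₂): S is a GNS and S is the ≼_R-minimum of its orbit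
  -- [S] = {id(S), swap(S)} (P₂ = {id, swap}; S ≼R S holds trivially)
  InR : Subset → Set
  InR S = IsGNS S × (S ≼R S) × (S ≼R swapS S)

  _∪｛_｝ : Subset → Pt → Subset
  (T ∪｛ f ｝) x = T x ⊎ (x ≡ f)

  data Desc (S : Subset) : Subset → Set₁ where
    base : ∀ {T} → InR T → T ≐ S → Desc S T
    step : ∀ {T T' f} → InR T → IsFrob T f → T' ≐ (T ∪｛ f ｝) → Desc S T' → Desc S T

  Atom : Subset → Pt → Set
  Atom S x = S x × x ≢ 𝟎 × ¬ (∃ λ y → ∃ λ z → S y × y ≢ 𝟎 × S z × z ≢ 𝟎 × x ≡ y ⊕ z)

  InU : Subset → Pt → Pt → Set
  InU T f x = Atom T x × (f ≺ x)

_∖｛_｝ : Subset → Pt → Subset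
(T ∖｛ n ｝) x = T x × (x ≢ n)

{-# OPTIONS --safe #-}
-- Going from a tree node up to its parent adds the Frobenius element, which lies above
-- every gap. Hence "e₂ ∈ T and some gap of T lies above e₂" passes from S down to every
-- descendant T. For such T, e₁ is a gap, and an atom n above F(T) is none of the
-- multiples k e₂. So e₁, the least nonzero point, is the least gap of T ∖ {n}, while
-- swap (T ∖ {n}) contains the whole axis ℕ e₁ and so has least gap e₂. Since e₁ ≺ e₂,
-- the gap sequences of T ∖ {n} and its swap first differ in their first entries, in
-- favour of T ∖ {n}.
module Submission where

open import Defs
open import Data.Product using (∃; _×_; _,_; proj₁; proj₂)
open import Relation.Nullary using (¬_; yes; no)
open import Data.Nat using (zero; suc)
open import Data.Nat.Properties using (+-identityʳ)
open import Data.Product.Properties using (≡-dec)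
open import Data.Sum using (inj₁; inj₂)
open import Data.Empty using (⊥-elim)
open import Data.List using (List; []; _∷_; map; deduplicate)
open import Data.List.Membership.Propositional using (_∈_)
open import Data.List.Membership.Propositional.Properties
  using (∈-map⁺; ∈-map⁻; ∈-deduplicate⁺; ∈-deduplicate⁻)
open import Data.List.Relation.Unary.Any using (here; there)
import Data.List.Relation.Unary.All as All
open import Data.List.Relation.Unary.AllPairs using (_∷_)
open import Data.List.Relation.Unary.Linked as Linked using (Linked)
open import Data.List.Relation.Unary.Linked.Properties using (AllPairs⇒Linked; Linked⇒AllPairs)
open import Data.List.Relation.Unary.Unique.Propositional using (Unique)
open import Data.List.Relation.Unary.Unique.DecPropositional.Properties using (deduplicate-!)
open import Data.List.Relation.Binary.Permutation.Propositional using (↭-sym; ↭⇒↭ₛ)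
open import Data.List.Relation.Binary.Permutation.Propositional.Properties using (∈-resp-↭)
import Data.List.Relation.Binary.Permutation.Setoid.Properties as Permutationₛ
import Data.List.Extrema
import Data.List.Sort
open import Function using (id)
open import Relation.Binary using (DecidableEquality; Decidable; DecTotalOrder; TotalOrder)
open import Relation.Binary.PropositionalEquality using (_≡_; _≢_; refl; sym; trans; subst; setoid)
open import Relation.Binary.Structures using (IsTotalOrder)
import Relation.Binary.Construct.NonStrictToStrict as NonStrictToStrict

infix 4 _≟_
_≟_ : DecidableEquality Pt
_≟_ = ≡-dec Data.Nat._≟_ Data.Nat._≟_

⊕-identityʳ : ∀ x → x ⊕ 𝟎 ≡ x
⊕-identityʳ (a , b) rewrite +-identityʳ a | +-identityʳ b = refl

swap-involutive : ∀ x → swap (swap x) ≡ x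
swap-involutive (a , b) = refl

e₂-multiples : ∀ {S} → IsGNS S → S e₂ → ∀ k → S (k , 0)
e₂-multiples G e₂∈S zero = IsGNS.has-zero G
e₂-multiples G e₂∈S (suc k) = IsGNS.closed G e₂ (k , 0) e₂∈S (e₂-multiples G e₂∈S k)

e₁-e₂-generate : ∀ {S} → IsGNS S → S e₁ → S e₂ → ∀ x → S x
e₁-e₂-generate G e₁∈S e₂∈S (zero , zero) = IsGNS.has-zero G
e₁-e₂-generate G e₁∈S e₂∈S (zero , suc b) =
  IsGNS.closed G e₁ (0 , b) e₁∈S (e₁-e₂-generate G e₁∈S e₂∈S (0 , b))
e₁-e₂-generate G e₁∈S e₂∈S (suc a , b) =
  IsGNS.closed G e₂ (a , b) e₂∈S (e₁-e₂-generate G e₁∈S e₂∈S (a , b))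

swap-∈⁺ : ∀ {x xs} → swap x ∈ xs → x ∈ map swap xs
swap-∈⁺ {x} p = subst (_∈ map swap _) (swap-involutive x) (∈-map⁺ swap p)

swap-∈⁻ : ∀ {x xs} → x ∈ map swap xs → swap x ∈ xs
swap-∈⁻ p with ∈-map⁻ swap p
... | z , z∈xs , refl = subst (_∈ _) (sym (swap-involutive z)) z∈xs

swap-isGNS : ∀ {S} → IsGNS S → IsGNS (swapS S)
swap-isGNS {S} record { has-zero = 𝟎∈S ; closed = closed ; finite-gaps = L , gaps } = record
  { has-zero = 𝟎∈S
  ; closed = closed-swap
  ; finite-gaps = map swap L , λ x → (λ x∉ → swap-∈⁺ (proj₁ (gaps (swap x)) x∉))
                                   , (λ x∈ → proj₂ (gaps (swap x)) (swap-∈⁻ x∈))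
  }
  where
    closed-swap : ∀ x y → swapS S x → swapS S y → swapS S (x ⊕ y)
    closed-swap (a , b) (c , d) = closed (b , a) (d , c)

module _ (_≼_ : Pt → Pt → Set) where

  Desc-isGNS : ∀ {S T} → Desc _≼_ S T → IsGNS T
  Desc-isGNS (base (G , _) _) = G
  Desc-isGNS (step (G , _) _ _ _) = G

  ∖-atom-isGNS : ∀ {T n} → IsGNS T → Atom _≼_ T n → IsGNS (T ∖｛ n ｝)
  ∖-atom-isGNS {T} {n} G@record { finite-gaps = L , gaps } (_ , n≢𝟎 , indecomposable) = record
    { has-zero = has-zero , λ 𝟎≡n → n≢𝟎 (sym 𝟎≡n)
    ; closed = closed∖n
    ; finite-gaps = n ∷ L , λ x → gap⇒∈ x , ∈⇒gap x
    }
    where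
      open IsGNS G using (has-zero; closed)

      closed∖n : ∀ x y → (T ∖｛ n ｝) x → (T ∖｛ n ｝) y → (T ∖｛ n ｝) (x ⊕ y)
      closed∖n x y (x∈T , x≢n) (y∈T , y≢n) = closed x y x∈T y∈T , x⊕y≢n
        where
          x⊕y≢n : x ⊕ y ≢ n
          x⊕y≢n eq with x ≟ 𝟎 | y ≟ 𝟎
          ... | yes refl | _        = y≢n eq
          ... | no _     | yes refl = x≢n (trans (sym (⊕-identityʳ x)) eq)
          ... | no x≢𝟎   | no y≢𝟎   = indecomposable (x , y , x∈T , x≢𝟎 , y∈T , y≢𝟎 , sym eq)

      gap⇒∈ : ∀ x → ¬ (T ∖｛ n ｝) x → x ∈ n ∷ L
      gap⇒∈ x x∉ with x ≟ n
      ... | yes x≡n = here x≡n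
      ... | no x≢n  = there (proj₁ (gaps x) (λ x∈T → x∉ (x∈T , x≢n)))

      ∈⇒gap : ∀ x → x ∈ n ∷ L → ¬ (T ∖｛ n ｝) x
      ∈⇒gap x (here x≡n)  (_ , x≢n) = x≢n x≡n
      ∈⇒gap x (there x∈L) (x∈T , _) = proj₂ (gaps x) x∈L x∈T

  e₂-multiple≢atom : ∀ {T n} → IsGNS T → T e₂ → Atom _≼_ T n → n ≢ e₂ → ∀ k → (k , 0) ≢ n
  e₂-multiple≢atom _ _ (_ , n≢𝟎 , _) _ zero 𝟎≡n = n≢𝟎 (sym 𝟎≡n)
  e₂-multiple≢atom _ _ _ n≢e₂ (suc zero) e₂≡n = n≢e₂ (sym e₂≡n)
  e₂-multiple≢atom G e₂∈T (_ , _ , indecomposable) _ (suc (suc k)) refl =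
    indecomposable (e₂ , (suc k , 0) , e₂∈T , (λ ()) , e₂-multiples G e₂∈T (suc k) , (λ ()) , refl)

module RelaxedMonomialOrder (_≼_ : Pt → Pt → Set) (isRMO : IsRelaxedMonomialOrder _≼_) where

  open IsRelaxedMonomialOrder isRMO
  open IsTotalOrder isTotalOrder
    using (total; antisym; isPartialOrder; ≤-respʳ-≈) renaming (refl to ≼-refl; trans to ≼-trans)
  open NonStrictToStrict _≡_ _≼_ using (_<_; <-irrefl; <⇒≱)

  <-trans : ∀ {x y z} → x < y → y < z → x < z
  <-trans = NonStrictToStrict.<-trans _≡_ _≼_ isPartialOrder

  <-≼-trans : ∀ {x y z} → x < y → y ≼ z → x < z
  <-≼-trans = NonStrictToStrict.<-≤-trans _≡_ _≼_ sym ≼-trans antisym ≤-respʳ-≈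

  ≼-⊕ : ∀ v u → v ≼ (v ⊕ u)
  ≼-⊕ v u with total v (v ⊕ u) | v ⊕ u ≟ v
  ... | inj₁ v≼v⊕u | _       = v≼v⊕u
  ... | inj₂ _     | yes eq  = subst (v ≼_) (sym eq) ≼-refl
  ... | inj₂ v⊕u≼v | no v⊕u≢v = ⊥-elim (<-irrefl refl (compat (v ⊕ u) v u (v⊕u≼v , v⊕u≢v)))

  _≼?_ : Decidable _≼_
  x ≼? y with total x y | x ≟ y
  ... | inj₁ x≼y | _        = yes x≼y
  ... | inj₂ _   | yes refl = yes ≼-refl
  ... | inj₂ y≼x | no x≢y   = no (λ x≼y → x≢y (antisym x≼y y≼x))

  decTotalOrder : DecTotalOrder _ _ _
  decTotalOrder = record
    { Carrier = Pt
    ; _≈_ = _≡_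
    ; _≤_ = _≼_
    ; isDecTotalOrder = record { isTotalOrder = isTotalOrder ; _≟_ = _≟_ ; _≤?_ = _≼?_ }
    }

  totalOrder : TotalOrder _ _ _
  totalOrder = DecTotalOrder.totalOrder decTotalOrder

  open Data.List.Sort decTotalOrder using (sort; sort-↭; sort-↗)
  open Data.List.Extrema totalOrder using (max; xs≤max; argmax-all)

  strictSort : List Pt → List Pt
  strictSort xs = sort (deduplicate _≟_ xs)

  strictSort-↗ : ∀ xs → Linked _<_ (strictSort xs)
  strictSort-↗ xs = Linked.zip (sort-↗ _ , AllPairs⇒Linked unique)
    where
      unique : Unique (strictSort xs)
      unique = Permutationₛ.Unique-resp-↭ (setoid Pt) (↭⇒↭ₛ (↭-sym (sort-↭ _))) (deduplicate-! _≟_ xs)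

  ∈-strictSort⁺ : ∀ {x xs} → x ∈ xs → x ∈ strictSort xs
  ∈-strictSort⁺ x∈xs = ∈-resp-↭ (↭-sym (sort-↭ _)) (∈-deduplicate⁺ _≟_ x∈xs)

  ∈-strictSort⁻ : ∀ {x xs} → x ∈ strictSort xs → x ∈ xs
  ∈-strictSort⁻ {xs = xs} x∈ = ∈-deduplicate⁻ _≟_ xs (∈-resp-↭ (sort-↭ _) x∈)

  frobenius-exists : ∀ {S g} → IsGNS S → ¬ S g → ∃ (IsFrob _≼_ S)
  frobenius-exists {S} {g} record { finite-gaps = L , gaps } g∉S =
      max g L
    , argmax-all id {P = λ x → ¬ S x} g∉S (All.tabulate (proj₂ (gaps _)))
    , λ h h∉S → All.lookup (xs≤max g L) (proj₁ (gaps h) h∉S)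

  gapSeq-exists : ∀ {S} → IsGNS S → ∃ (GapSeq _≼_ S)
  gapSeq-exists record { finite-gaps = L , gaps } =
    strictSort L , strictSort-↗ L , λ x → (λ x∈ → proj₂ (gaps x) (∈-strictSort⁻ x∈))
                                        , (λ x∉ → ∈-strictSort⁺ (proj₁ (gaps x) x∉))

  IsLeastGap : Subset → Pt → Set
  IsLeastGap S m = ¬ S m × (∀ h → ¬ S h → m ≼ h)

  gapSeq-head : ∀ {S hs m} → GapSeq _≼_ S hs → IsLeastGap S m → ∃ λ rs → hs ≡ m ∷ rs
  gapSeq-head (sorted , gaps) (m∉S , m-least) with proj₂ (gaps _) m∉S | Linked⇒AllPairs <-trans sorted
  ... | here refl          | _ = _ , refl
  ... | there {x = h} m∈rs | h<rs ∷ _ =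
    ⊥-elim (<⇒≱ antisym (All.lookup h<rs m∈rs) (m-least h (proj₁ (gaps h) (here refl))))

  gapSeq-from-leastGap : ∀ {S m} → IsGNS S → IsLeastGap S m → ∃ λ rs → GapSeq _≼_ S (m ∷ rs)
  gapSeq-from-leastGap G least with gapSeq-exists G
  ... | hs , seq with gapSeq-head seq least
  ...   | rs , refl = rs , seq

  ≼R-byLeastGap : ∀ {S S′ m m′} → IsGNS S → IsGNS S′ → IsLeastGap S m → IsLeastGap S′ m′ → m < m′ →
                  _≼R_ _≼_ S S′
  ≼R-byLeastGap G G′ least least′ m<m′
    with gapSeq-from-leastGap G least | gapSeq-from-leastGap G′ least′
  ... | rs , seq | rs′ , seq′ = inj₂ (_ , _ , seq , seq′ , [] , _ , _ , rs , rs′ , refl , refl , m<m′)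

  HasGapAbove : Subset → Pt → Set
  HasGapAbove T v = ∃ λ g → ¬ T g × v < g

  Desc-preserves-∈-below-gap : ∀ {S T v} → Desc _≼_ S T → S v → HasGapAbove S v →
                               T v × HasGapAbove T v
  Desc-preserves-∈-below-gap (base _ T≐S) v∈S (g , g∉S , v<g) =
    proj₂ (T≐S _) v∈S , g , (λ g∈T → g∉S (proj₁ (T≐S g) g∈T)) , v<g
  Desc-preserves-∈-below-gap {T = T} {v} (step _ (_ , f-max) T′≐T∪f S↝T′) v∈S above
    with Desc-preserves-∈-below-gap S↝T′ v∈S above
  ... | v∈T′ , g , g∉T′ , v<g = v∈T , g , g∉T , v<g
    where
      g∉T : ¬ T g
      g∉T g∈T = g∉T′ (proj₂ (T′≐T∪f g) (inj₁ g∈T))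

      v∈T : T v
      v∈T with proj₁ (T′≐T∪f v) v∈T′
      ... | inj₁ v∈T = v∈T
      ... | inj₂ refl = ⊥-elim (<⇒≱ antisym v<g (f-max g g∉T))

  e₁-least-nonzero : e₁ < e₂ → ∀ {x} → x ≢ 𝟎 → e₁ ≼ x
  e₁-least-nonzero _ {zero , zero} x≢𝟎 = ⊥-elim (x≢𝟎 refl)
  e₁-least-nonzero _ {zero , suc b} _ = ≼-⊕ e₁ (0 , b)
  e₁-least-nonzero (e₁≼e₂ , _) {suc a , b} _ = ≼-trans e₁≼e₂ (≼-⊕ e₂ (a , b))

  ∖-atom-inR : ∀ {T f n} → e₁ < e₂ → IsGNS T → T e₂ → HasGapAbove T e₂ →
               IsFrob _≼_ T f → InU _≼_ T f n → InR _≼_ (T ∖｛ n ｝)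
  ∖-atom-inR {T} {f} {n} e₁<e₂ G e₂∈T (g , g∉T , e₂<g) (_ , f-max) (n-atom , f<n) =
    G∖n , inj₁ (λ _ → id , id) , ≼R-byLeastGap G∖n (swap-isGNS G∖n) e₁-least e₂-least e₁<e₂
    where
      G∖n : IsGNS (T ∖｛ n ｝)
      G∖n = ∖-atom-isGNS _≼_ G n-atom

      e₁∉T : ¬ T e₁
      e₁∉T e₁∈T = g∉T (e₁-e₂-generate G e₁∈T e₂∈T g)

      n≢e₂ : n ≢ e₂
      n≢e₂ refl = <-irrefl refl (<-trans (<-≼-trans e₂<g (f-max g g∉T)) f<n)

      e₁-least : IsLeastGap (T ∖｛ n ｝) e₁
      e₁-least = (λ (e₁∈T , _) → e₁∉T e₁∈T)
               , λ h h∉ → e₁-least-nonzero e₁<e₂ (λ { refl → h∉ (IsGNS.has-zero G∖n) })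

      e₂-below-swapped-gaps : ∀ h → ¬ swapS (T ∖｛ n ｝) h → e₂ ≼ h
      e₂-below-swapped-gaps (zero , b) h∉ =
        ⊥-elim (h∉ (e₂-multiples G e₂∈T b , e₂-multiple≢atom _≼_ G e₂∈T n-atom n≢e₂ b))
      e₂-below-swapped-gaps (suc a , b) _ = ≼-⊕ e₂ (a , b)

      e₂-least : IsLeastGap (swapS (T ∖｛ n ｝)) e₂
      e₂-least = (λ (e₁∈T , _) → e₁∉T e₁∈T) , e₂-below-swapped-gaps

mainTheorem10 : (_≼_ : Pt → Pt → Set) → IsRelaxedMonomialOrder _≼_ → _≺_ _≼_ e₁ e₂ →
    (S : Subset) → InR _≼_ S → ¬ (∀ x → S x) → S e₂ →
    (∀ f → IsFrob _≼_ S f → _≺_ _≼_ e₂ f) →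
    (T : Subset) → Desc _≼_ S T →
    (fT n : Pt) → IsFrob _≼_ T fT → InU _≼_ T fT n →
    InR _≼_ (T ∖｛ n ｝)
mainTheorem10 _≼_ isRMO e₁≺e₂ S (S-isGNS , _) S≢ℕ² e₂∈S e₂≺F[S] T S↝T fT n F[T] n∈U =
  let e₂∈T , gap-above-e₂-in-T = Desc-preserves-∈-below-gap S↝T e₂∈S gap-above-e₂-in-S
  in ∖-atom-inR e₁≺e₂ (Desc-isGNS _≼_ S↝T) e₂∈T gap-above-e₂-in-T F[T] n∈U
  where
    open RelaxedMonomialOrder _≼_ isRMO

    e₁∉S : ¬ S e₁
    e₁∉S e₁∈S = S≢ℕ² (e₁-e₂-generate S-isGNS e₁∈S e₂∈S)

    gap-above-e₂-in-S : HasGapAbove S e₂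
    gap-above-e₂-in-S with frobenius-exists S-isGNS e₁∉S
    ... | F , F[S] = F , proj₁ F[S] , e₂≺F[S] F F[S]
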